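{- Let $n\ge0$ and $A,B\subseteq\{0,1,\dots,n\}$ with $|A+B|>|(A-B)\cup(B-A)|$. Then there exist $a_1<a_2<a_3$ in $A$ and $b_1<b_2<b_3$ in $B$ such that $a_1+b_3=a_2+b_2=a_3+b_1$.
   Context: $A+B=\{a+b:a\in A,b\in B\}$, $A-B=\{a-b:a\in A,b\in B\}$. -}

module Defs where

open import Data.Nat using (ℕ; suc; _+_)
open import Data.Fin using (Fin; toℕ)
open import Data.Fin.Subset using (Subset; _∈_; inside; outside)
open import Data.Fin.Subset.Properties using (_∈?_)
open import Data.Fin.Properties using (any?)
open import Data.Product using (_×_)
open import Data.Sum using (_⊎_)
open import Data.Vec using (tabulate)
open import Data.Bool using (if_then_else_)
open import Relation.Nullary using (does)
open import Relation.Nullary.Decidable using (_×-dec_; _⊎-dec_)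
open import Data.Nat.Properties using (_≟_)

-- Subsets of {0,1,...,n} are modelled as Subset (suc n): element i : Fin (suc n)
-- stands for the natural number toℕ i.

sumset : ∀ {n} → Subset (suc n) → Subset (suc n) → Subset (suc (n + n))
sumset {n} A B = tabulate λ k →
  if does (any? λ a → any? λ b →
        (a ∈? A) ×-dec ((b ∈? B) ×-dec (toℕ a + toℕ b ≟ toℕ k)))
  then inside else outside

-- (A - B) ∪ (B - A) ⊆ {-n,...,n}, encoded by shifting by n: index k : Fin (2n+1)
-- represents the integer d = k - n. d ∈ A - B iff a - b = k - n, i.e. a + n = b + k;
-- d ∈ B - A iff b - a = k - n, i.e. b + n = a + k.
diffUnion : ∀ {n} → Subset (suc n) → Subset (suc n) → Subset (suc (n + n))
diffUnion {n} A B = tabulate λ k →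
  if does (any? λ a → any? λ b →
        (a ∈? A) ×-dec ((b ∈? B) ×-dec
          ((toℕ a + n ≟ toℕ b + toℕ k) ⊎-dec (toℕ b + n ≟ toℕ a + toℕ k))))
  then inside else outside

{-# OPTIONS --safe #-}
module Submission where

-- The pairs in the conclusion are three representations a₁ + b₃ = a₂ + b₂ = a₃ + b₁
-- of one element of A + B (the order of the bᵢ is forced by that of the aᵢ). So
-- suppose every sum has at most two representations; we show |A + B| ≤ |A − B|.
-- For a ∈ A write w ⟶ₐ w′ when a′ + w = a + w′ for some a′ < a in A: then (a′, w′)
-- is a lower point of A × B on the diagonal through (a, w), and by the bound on
-- representations every w′ has at most one ⟶ₐ-predecessor. Map a sum s to a − z,
-- where (a, y) is its representation with least a, so that y is a ⟶ₐ-source, and z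
-- is a ⟶ₐ-sink reached from y. A sink (a, z) is the lowest point of A × B on its
-- diagonal, so equal images force equal a, hence equal z, and uniqueness of
-- predecessors traces the paths back to equal y.

open import Defs
open import Level using (0ℓ)
open import Data.Bool.Base using (if_then_else_)
open import Data.Empty using (⊥-elim)
open import Data.Fin.Base using (Fin; toℕ; fromℕ<)
open import Data.Fin.Properties using (any?; <-cmp; suc-injective; toℕ-injective; toℕ-fromℕ<; toℕ≤pred[n])
open import Data.Fin.Subset using (Subset; _∈_; _⊆_; _-_; ∣_∣; inside; outside)
open import Data.Fin.Subset.Properties using (_∈?_; p⊆q⇒∣p∣≤∣q∣; x∈p∧x≢y⇒x∈p-y; x∈p⇒∣p-x∣<∣p∣)
import Data.List.Base as List
open import Data.Nat.Base using (ℕ; suc; _+_; _∸_; _≤_; _<_; z≤n; s≤s)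
open import Data.Nat.Induction using (<-wellFounded)
open import Data.Nat.Properties
  using (_≟_; _<?_; ≤-trans; ≤-<-trans; <⇒≱; m∸n≤m; m≤n+m; m+[n∸m]≡n; +-monoˡ-≤; +-monoˡ-<; +-cancelˡ-<; +-cancelˡ-≡; +-cancelʳ-≡)
open import Data.Nat.Tactic.RingSolver using (solve)
open import Data.Product using (Σ; ∃; ∄; _×_; _,_; proj₁)
open import Data.Sum using (inj₁)
open import Data.Vec.Base using ([]; _∷_; tabulate; lookup; here; there)
open import Data.Vec.Properties using (lookup∘tabulate; []=⇒lookup; lookup⇒[]=)
open import Function using (_∘_; id; flip)
open import Induction.WellFounded using (Acc; acc)
open import Relation.Binary.Core using (Rel)
open import Relation.Binary.Construct.Closure.ReflexiveTransitive using (Star; ε; _◅_; reverse)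
open import Relation.Binary.Definitions using (tri<; tri≈; tri>)
open import Relation.Binary.PropositionalEquality using (_≡_; refl; sym; trans; cong; subst; module ≡-Reasoning)
open import Relation.Nullary using (¬_; Dec; yes; no; does; contradiction)
open import Relation.Nullary.Decidable using (_×-dec_; _⊎-dec_; map′; dec-true)
open import Relation.Unary using (Pred; Decidable)

open ≡-Reasoning

antidiagonal-< : ∀ {x y x′ y′} → x < x′ → x + y ≡ x′ + y′ → y′ < y
antidiagonal-< {x} {y} {x′} {y′} x<x′ eq =
  +-cancelˡ-< x y′ y (subst (x + y′ <_) (sym eq) (+-monoˡ-< y′ x<x′))

cross-sums : ∀ {a b a′ b′ n s} → a + n ≡ b + s → a′ + n ≡ b′ + s → a + b′ ≡ a′ + b
cross-sums {a} {b} {a′} {b′} {n} {s} eq eq′ = +-cancelʳ-≡ n _ _ (begin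
  a + b′ + n   ≡⟨ solve (a List.∷ b′ List.∷ n List.∷ List.[]) ⟩
  (a + n) + b′ ≡⟨ cong (_+ b′) eq ⟩
  (b + s) + b′ ≡⟨ solve (b List.∷ s List.∷ b′ List.∷ List.[]) ⟩
  (b′ + s) + b ≡⟨ cong (_+ b) eq′ ⟨
  (a′ + n) + b ≡⟨ solve (a′ List.∷ n List.∷ b List.∷ List.[]) ⟩
  a′ + b + n   ∎)

injection⇒∣p∣≤∣q∣ : ∀ {m m′} {p : Subset m} {q : Subset m′} (f : ∀ {i} → i ∈ p → Fin m′) →
  (∀ {i} (i∈p : i ∈ p) → f i∈p ∈ q) →
  (∀ {i j} (i∈p : i ∈ p) (j∈p : j ∈ p) → f i∈p ≡ f j∈p → i ≡ j) →
  ∣ p ∣ ≤ ∣ q ∣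
injection⇒∣p∣≤∣q∣ {p = []} f f∈q f-injective = z≤n
injection⇒∣p∣≤∣q∣ {p = outside ∷ p} f f∈q f-injective =
  injection⇒∣p∣≤∣q∣ (f ∘ there) (f∈q ∘ there)
    (λ i∈p j∈p → suc-injective ∘ f-injective (there i∈p) (there j∈p))
injection⇒∣p∣≤∣q∣ {p = inside ∷ p} {q} f f∈q f-injective =
  ≤-<-trans ∣p∣≤∣q-f₀∣ (x∈p⇒∣p-x∣<∣p∣ (f∈q here))
  where
  ∣p∣≤∣q-f₀∣ : ∣ p ∣ ≤ ∣ q - f here ∣
  ∣p∣≤∣q-f₀∣ = injection⇒∣p∣≤∣q∣ (f ∘ there)
    (λ i∈p → x∈p∧x≢y⇒x∈p-y (f∈q (there i∈p)) (λ eq → contradiction (f-injective (there i∈p) here eq) λ ()))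
    (λ i∈p j∈p → suc-injective ∘ f-injective (there i∈p) (there j∈p))

select : ∀ {m} {P : Pred (Fin m) 0ℓ} → Decidable P → Subset m
select P? = tabulate λ i → if does (P? i) then inside else outside

module _ {m} {P : Pred (Fin m) 0ℓ} (P? : Decidable P) where

  ∈-select⁺ : ∀ {i} → P i → i ∈ select P?
  ∈-select⁺ {i} Pi = lookup⇒[]= i (select P?) (begin
    lookup (select P?) i                      ≡⟨ lookup∘tabulate _ i ⟩
    (if does (P? i) then inside else outside) ≡⟨ cong (if_then inside else outside) (dec-true (P? i) Pi) ⟩
    inside                                    ∎)

  ∈-select⁻ : ∀ {i} → i ∈ select P? → P i
  ∈-select⁻ {i} i∈ with P? i | trans (sym (lookup∘tabulate _ i)) ([]=⇒lookup i∈)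
  ... | yes Pi | _ = Pi
  ... | no _   | ()

module _ {X : Set} (_⟶_ : Rel X 0ℓ) where

  Sink Source : X → Set
  Sink x = ∄ λ y → x ⟶ y
  Source y = ∄ λ x → x ⟶ y

reachable-sink : ∀ {X : Set} {_⟶_ : Rel X 0ℓ} (μ : X → ℕ) →
  (∀ {x y} → x ⟶ y → μ y < μ x) → (∀ x → Dec (∃ λ y → x ⟶ y)) →
  ∀ x → ∃ λ z → Star _⟶_ x z × Sink _⟶_ z
reachable-sink {_⟶_ = _⟶_} μ μ-decreasing successor? x = descend x (<-wellFounded (μ x))
  where
  descend : ∀ x → Acc _<_ (μ x) → ∃ λ z → Star _⟶_ x z × Sink _⟶_ z
  descend x (acc smaller) with successor? x
  ... | no x-sink = x , ε , x-sink
  ... | yes (y , x⟶y) with descend y (smaller (μ-decreasing x⟶y))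
  ...   | z , y⟶*z , z-sink = z , x⟶y ◅ y⟶*z , z-sink

sources-unique : ∀ {X : Set} {_⟶_ : Rel X 0ℓ} →
  (∀ {x y z} → x ⟶ z → y ⟶ z → x ≡ y) →
  ∀ {x y z} → Source _⟶_ x → Source _⟶_ y → Star _⟶_ x z → Star _⟶_ y z → x ≡ y
sources-unique {_⟶_ = _⟶_} left-unique x-source y-source x⟶*z y⟶*z =
  backwards x-source y-source (reverse id x⟶*z) (reverse id y⟶*z)
  where
  backwards : ∀ {x y z} → Source _⟶_ x → Source _⟶_ y →
    Star (flip _⟶_) z x → Star (flip _⟶_) z y → x ≡ y
  backwards _        _        ε            ε            = refl
  backwards x-source _        ε            (w⟶x ◅ _)    = ⊥-elim (x-source (_ , w⟶x))
  backwards _        y-source (w⟶y ◅ _)    ε            = ⊥-elim (y-source (_ , w⟶y))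
  backwards x-source y-source (u⟶z ◅ u⟵x) (v⟶z ◅ v⟵y) with left-unique u⟶z v⟶z
  ... | refl = backwards x-source y-source u⟵x v⟵y

module _ {n : ℕ} where

  difference : Fin (suc n) → Fin (suc n) → Fin (suc (n + n))
  difference a b = fromℕ< (s≤s (≤-trans (m∸n≤m (toℕ a + n) (toℕ b)) (+-monoˡ-≤ n (toℕ≤pred[n] a))))

  difference-spec : ∀ a b → toℕ a + n ≡ toℕ b + toℕ (difference a b)
  difference-spec a b = begin
    toℕ a + n                    ≡⟨ m+[n∸m]≡n (≤-trans (toℕ≤pred[n] b) (m≤n+m n (toℕ a))) ⟨
    toℕ b + (toℕ a + n ∸ toℕ b)  ≡⟨ cong (toℕ b +_) (toℕ-fromℕ< _) ⟨
    toℕ b + toℕ (difference a b) ∎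

  difference-cross : ∀ {a b a′ b′} → difference a b ≡ difference a′ b′ → toℕ a + toℕ b′ ≡ toℕ a′ + toℕ b
  difference-cross {a} {b} {a′} {b′} eq =
    cross-sums {toℕ a} {toℕ b} {toℕ a′} {toℕ b′} (difference-spec a b)
      (subst (λ s → toℕ a′ + n ≡ toℕ b′ + toℕ s) (sym eq) (difference-spec a′ b′))

module _ {n : ℕ} (A B : Subset (suc n)) where

  TripleRepresentation : Set
  TripleRepresentation =
    Σ (Fin (suc n)) λ a₁ → Σ (Fin (suc n)) λ a₂ → Σ (Fin (suc n)) λ a₃ →
    Σ (Fin (suc n)) λ b₁ → Σ (Fin (suc n)) λ b₂ → Σ (Fin (suc n)) λ b₃ →
      (a₁ ∈ A × a₂ ∈ A × a₃ ∈ A × b₁ ∈ B × b₂ ∈ B × b₃ ∈ B) ×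
      (toℕ a₁ < toℕ a₂ × toℕ a₂ < toℕ a₃) ×
      (toℕ b₁ < toℕ b₂ × toℕ b₂ < toℕ b₃) ×
      (toℕ a₁ + toℕ b₃ ≡ toℕ a₂ + toℕ b₂ × toℕ a₂ + toℕ b₂ ≡ toℕ a₃ + toℕ b₁)

  triple? : Dec TripleRepresentation
  triple? =
    any? λ a₁ → any? λ a₂ → any? λ a₃ → any? λ b₁ → any? λ b₂ → any? λ b₃ →
      ((a₁ ∈? A) ×-dec (a₂ ∈? A) ×-dec (a₃ ∈? A) ×-dec (b₁ ∈? B) ×-dec (b₂ ∈? B) ×-dec (b₃ ∈? B)) ×-dec
      ((toℕ a₁ <? toℕ a₂) ×-dec (toℕ a₂ <? toℕ a₃)) ×-dec
      ((toℕ b₁ <? toℕ b₂) ×-dec (toℕ b₂ <? toℕ b₃)) ×-dec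
      ((toℕ a₁ + toℕ b₃ ≟ toℕ a₂ + toℕ b₂) ×-dec (toℕ a₂ + toℕ b₂ ≟ toℕ a₃ + toℕ b₁))

  three-representations : ∀ {a₁ a₂ a₃ b₁ b₂ b₃} →
    a₁ ∈ A → a₂ ∈ A → a₃ ∈ A → b₁ ∈ B → b₂ ∈ B → b₃ ∈ B →
    toℕ a₁ < toℕ a₂ → toℕ a₂ < toℕ a₃ →
    toℕ a₁ + toℕ b₃ ≡ toℕ a₂ + toℕ b₂ → toℕ a₂ + toℕ b₂ ≡ toℕ a₃ + toℕ b₁ →
    TripleRepresentation
  three-representations a₁∈A a₂∈A a₃∈A b₁∈B b₂∈B b₃∈B a₁<a₂ a₂<a₃ eq₁₂ eq₂₃ =
    _ , _ , _ , _ , _ , _ , (a₁∈A , a₂∈A , a₃∈A , b₁∈B , b₂∈B , b₃∈B) ,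
    (a₁<a₂ , a₂<a₃) , (antidiagonal-< a₂<a₃ eq₂₃ , antidiagonal-< a₁<a₂ eq₁₂) , (eq₁₂ , eq₂₃)

  IsSum IsDifference : Pred (Fin (suc (n + n))) 0ℓ
  IsSum k = ∃ λ a → ∃ λ b → a ∈ A × b ∈ B × toℕ a + toℕ b ≡ toℕ k
  IsDifference k = ∃ λ a → ∃ λ b → a ∈ A × b ∈ B × toℕ a + n ≡ toℕ b + toℕ k

  isSum? : Decidable IsSum
  isSum? k = any? λ a → any? λ b → (a ∈? A) ×-dec (b ∈? B) ×-dec (toℕ a + toℕ b ≟ toℕ k)

  isDifference? : Decidable IsDifference
  isDifference? k = any? λ a → any? λ b → (a ∈? A) ×-dec (b ∈? B) ×-dec (toℕ a + n ≟ toℕ b + toℕ k)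

  differenceSet : Subset (suc (n + n))
  differenceSet = select isDifference?

  differenceSet⊆diffUnion : differenceSet ⊆ diffUnion A B
  differenceSet⊆diffUnion k∈ with ∈-select⁻ isDifference? k∈
  ... | a , b , a∈A , b∈B , eq = ∈-select⁺
    -- diffUnion A B is, definitionally, the selection by this decision procedure
    (λ k → any? λ a → any? λ b → (a ∈? A) ×-dec (b ∈? B) ×-dec
      ((toℕ a + n ≟ toℕ b + toℕ k) ⊎-dec (toℕ b + n ≟ toℕ a + toℕ k)))
    (a , b , a∈A , b∈B , inj₁ eq)

  difference∈differenceSet : ∀ {a b} → a ∈ A → b ∈ B → difference a b ∈ differenceSet
  difference∈differenceSet {a} {b} a∈A b∈B =
    ∈-select⁺ isDifference? (a , b , a∈A , b∈B , difference-spec a b)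

  _⇝_ : Rel (Fin (suc n) × Fin (suc n)) 0ℓ
  (a , b) ⇝ (a′ , b′) = a′ ∈ A × b′ ∈ B × toℕ a′ < toℕ a × toℕ a′ + toℕ b′ ≡ toℕ a + toℕ b

  _⟶[_]_ : Fin (suc n) → Fin (suc n) → Fin (suc n) → Set
  w ⟶[ a ] w′ = w′ ∈ B × ∃ λ a′ → (a , w′) ⇝ (a′ , w)

  ⇝-decreasing : ∀ {p q} → p ⇝ q → toℕ (proj₁ q) < toℕ (proj₁ p)
  ⇝-decreasing (_ , _ , a′<a , _) = a′<a

  _⇝?_ : ∀ p q → Dec (p ⇝ q)
  (a , b) ⇝? (a′ , b′) =
    (a′ ∈? A) ×-dec (b′ ∈? B) ×-dec (toℕ a′ <? toℕ a) ×-dec (toℕ a′ + toℕ b′ ≟ toℕ a + toℕ b)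

  ⇝-successor? : ∀ p → Dec (∃ λ q → p ⇝ q)
  ⇝-successor? p = map′ (λ (a′ , b′ , r) → (a′ , b′) , r) (λ ((a′ , b′) , r) → a′ , b′ , r)
    (any? λ a′ → any? λ b′ → p ⇝? (a′ , b′))

  ⇝*-representation : ∀ {a b a′ b′} → a ∈ A → b ∈ B → Star _⇝_ (a , b) (a′ , b′) →
    a′ ∈ A × b′ ∈ B × toℕ a′ + toℕ b′ ≡ toℕ a + toℕ b
  ⇝*-representation a∈A b∈B ε = a∈A , b∈B , refl
  ⇝*-representation _ _ ((a₁∈A , b₁∈B , _ , eq₁) ◅ rest) with ⇝*-representation a₁∈A b₁∈B rest
  ... | a′∈A , b′∈B , eq = a′∈A , b′∈B , trans eq eq₁

  ⟶-decreasing : ∀ {a w w′} → w ⟶[ a ] w′ → toℕ w′ < toℕ w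
  ⟶-decreasing (_ , _ , _ , _ , a′<a , eq) = antidiagonal-< a′<a eq

  ⟶-successor? : ∀ a w → Dec (∃ λ w′ → w ⟶[ a ] w′)
  ⟶-successor? a w = any? λ w′ → (w′ ∈? B) ×-dec any? λ a′ → (a , w′) ⇝? (a′ , w)

  ⟶*-∈ : ∀ {a w z} → w ∈ B → Star _⟶[ a ]_ w z → z ∈ B
  ⟶*-∈ w∈B ε = w∈B
  ⟶*-∈ _ ((w′∈B , _) ◅ rest) = ⟶*-∈ w′∈B rest

  module _ (no-triple : ¬ TripleRepresentation) where

    ⟶-left-unique : ∀ {a u v z} → a ∈ A → u ⟶[ a ] z → v ⟶[ a ] z → u ≡ v
    ⟶-left-unique a∈A (z∈B , a₁ , a₁∈A , u∈B , a₁<a , eq₁) (_ , a₂ , a₂∈A , v∈B , a₂<a , eq₂)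
      with <-cmp a₁ a₂
    ... | tri< a₁<a₂ _ _ = ⊥-elim (no-triple
          (three-representations a₁∈A a₂∈A a∈A z∈B v∈B u∈B a₁<a₂ a₂<a (trans eq₁ (sym eq₂)) eq₂))
    ... | tri≈ _ refl _ = toℕ-injective (+-cancelˡ-≡ (toℕ a₁) _ _ (trans eq₁ (sym eq₂)))
    ... | tri> _ _ a₂<a₁ = ⊥-elim (no-triple
          (three-representations a₂∈A a₁∈A a∈A z∈B u∈B v∈B a₂<a₁ a₁<a (trans eq₂ (sym eq₁)) eq₁))

    record SumChain (k : Fin (suc (n + n))) : Set where
      field
        a y z    : Fin (suc n)
        a∈A      : a ∈ A
        z∈B      : z ∈ B
        a+y≡k    : toℕ a + toℕ y ≡ toℕ k
        y-source : Source _⟶[ a ]_ y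
        y⟶*z     : Star _⟶[ a ]_ y z
        z-sink   : Sink _⟶[ a ]_ z

    sumChain : ∀ {k} → IsSum k → SumChain k
    sumChain (a₀ , b₀ , a₀∈A , b₀∈B , a₀+b₀≡k)
      with reachable-sink (toℕ ∘ proj₁) ⇝-decreasing ⇝-successor? (a₀ , b₀)
    ... | (a , y) , path , lowest with ⇝*-representation a₀∈A b₀∈B path
    ... | a∈A , y∈B , same-sum with reachable-sink toℕ ⟶-decreasing (⟶-successor? a) y
    ... | z , y⟶*z , z-sink = record
      { a = a ; y = y ; z = z
      ; a∈A = a∈A
      ; z∈B = ⟶*-∈ y∈B y⟶*z
      ; a+y≡k = trans same-sum a₀+b₀≡k
      ; y-source = λ (w , _ , a′ , r) → lowest ((a′ , w) , r)
      ; y⟶*z = y⟶*z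
      ; z-sink = z-sink
      }

    chainDifference : ∀ {k} → SumChain k → Fin (suc (n + n))
    chainDifference c = difference (SumChain.a c) (SumChain.z c)

    chainDifference-injective : ∀ {k k′} (c : SumChain k) (c′ : SumChain k′) →
      chainDifference c ≡ chainDifference c′ → k ≡ k′
    chainDifference-injective
      record { a = a ; y = y ; z = z ; a∈A = a∈A ; z∈B = z∈B ; a+y≡k = a+y≡k
             ; y-source = y-source ; y⟶*z = y⟶*z ; z-sink = z-sink }
      record { a = a′ ; y = y′ ; z = z′ ; a∈A = a′∈A ; z∈B = z′∈B ; a+y≡k = a′+y′≡k′
             ; y-source = y′-source ; y⟶*z = y′⟶*z′ ; z-sink = z′-sink }
      eq with <-cmp a a′ | difference-cross {a = a} {z} {a′} {z′} eq
    ... | tri< a<a′ _ _ | cross = ⊥-elim (z′-sink (z , z∈B , a , a∈A , z′∈B , a<a′ , cross))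
    ... | tri> _ _ a′<a | cross = ⊥-elim (z-sink (z′ , z′∈B , a′ , a′∈A , z∈B , a′<a , sym cross))
    ... | tri≈ _ refl _ | cross with toℕ-injective {i = z′} {j = z} (+-cancelˡ-≡ (toℕ a) _ _ cross)
    ...   | refl = toℕ-injective (begin
      toℕ _            ≡⟨ a+y≡k ⟨
      toℕ a + toℕ y    ≡⟨ cong (λ w → toℕ a + toℕ w) y≡y′ ⟩
      toℕ a + toℕ y′   ≡⟨ a′+y′≡k′ ⟩
      toℕ _            ∎)
      where
      y≡y′ : y ≡ y′
      y≡y′ = sources-unique (⟶-left-unique a∈A) y-source y′-source y⟶*z y′⟶*z′

    ∣A+B∣≤∣A-B∣ : ∣ sumset A B ∣ ≤ ∣ differenceSet ∣
    ∣A+B∣≤∣A-B∣ = injection⇒∣p∣≤∣q∣ (chainDifference ∘ chainOf)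
      (λ k∈ → difference∈differenceSet (SumChain.a∈A (chainOf k∈)) (SumChain.z∈B (chainOf k∈)))
      (λ k∈ k′∈ → chainDifference-injective (chainOf k∈) (chainOf k′∈))
      where
      chainOf : ∀ {k} → k ∈ sumset A B → SumChain k
      chainOf = sumChain ∘ ∈-select⁻ isSum?

lemma5p1 : (n : ℕ) (A B : Subset (suc n)) →
    ∣ diffUnion A B ∣ < ∣ sumset A B ∣ →
    Σ (Fin (suc n)) λ a₁ → Σ (Fin (suc n)) λ a₂ → Σ (Fin (suc n)) λ a₃ →
    Σ (Fin (suc n)) λ b₁ → Σ (Fin (suc n)) λ b₂ → Σ (Fin (suc n)) λ b₃ →
      (a₁ ∈ A × a₂ ∈ A × a₃ ∈ A × b₁ ∈ B × b₂ ∈ B × b₃ ∈ B) ×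
      (toℕ a₁ < toℕ a₂ × toℕ a₂ < toℕ a₃) ×
      (toℕ b₁ < toℕ b₂ × toℕ b₂ < toℕ b₃) ×
      (toℕ a₁ + toℕ b₃ ≡ toℕ a₂ + toℕ b₂ × toℕ a₂ + toℕ b₂ ≡ toℕ a₃ + toℕ b₁)
lemma5p1 n A B ∣D∣<∣A+B∣ with triple? A B
... | yes triple = triple
... | no no-triple = contradiction
  (≤-trans (∣A+B∣≤∣A-B∣ A B no-triple) (p⊆q⇒∣p∣≤∣q∣ (differenceSet⊆diffUnion A B)))
  (<⇒≱ ∣D∣<∣A+B∣)
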